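{- For the lollipop $L_{n,r}$ with $r<n$ and $r$ even, $$W(L_{n,r})=\frac{1}{6}\left[n^3+\left(-\frac{3}{2}r^2+3r-1\right)n+\left(\frac{5}{4}r^3-3r^2+r\right)\right].$$
   Context: $W$ denotes the Wiener index (sum of distances over all unordered vertex pairs). The lollipop $L_{n,r}$ is the $n$-vertex graph obtained by identifying a vertex of the cycle $C_r$ with an end-vertex of the path $P_{n-r+1}$ on $n-r+1$ vertices. -}

module Defs where

open import Data.Bool using (Bool; true; false; _∧_; _∨_; if_then_else_)
open import Data.Nat using (ℕ; zero; suc; _+_; _*_; _≡ᵇ_; _<ᵇ_)
open import Data.Fin using (Fin; toℕ)
open import Data.List using (List; map; allFin)
open import Data.Nat.ListAction using (sum)
open import Data.Bool.ListAction using (any)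

record Graph (n : ℕ) : Set where
  field
    adj : Fin n → Fin n → Bool

open Graph public

reach : ∀ {n} → Graph n → ℕ → Fin n → Fin n → Bool
reach {n} G zero    u v = toℕ u ≡ᵇ toℕ v
reach {n} G (suc k) u v =
  reach G k u v ∨ any (λ w → reach G k u w ∧ adj G w v) (allFin n)

-- least k < bound with reach G k u v (returns bound if none).
firstReach : ∀ {n} → Graph n → Fin n → Fin n → ℕ → ℕ → ℕ
firstReach G u v k zero = k
firstReach G u v k (suc fuel) =
  if reach G k u v then k else firstReach G u v (suc k) fuel

-- Graph distance: the length of a shortest u–v walk.  In a connected graph on
-- n vertices this is < n, so searching k = 0,1,…,n-1 is exhaustive.
dist : ∀ {n} → Graph n → Fin n → Fin n → ℕ
dist {n} G u v = firstReach G u v 0 n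

wiener : ∀ {n} → Graph n → ℕ
wiener {n} G =
  sum (map (λ u → sum (map (λ v → if toℕ u <ᵇ toℕ v then dist G u v else 0) (allFin n))) (allFin n))

-- Lollipop L_{n,r}: vertices 0,…,n-1.  Cycle C_r on 0,…,r-1 (edges {i,i+1}, i<r-1,
-- plus {0,r-1}); path P_{n-r+1} on r-1,r,…,n-1 (edges {i,i+1}), glued at vertex r-1.
-- Together: edges {i,i+1} for all i < n-1, plus the closing edge {0,r-1}.
lollipopAdj : ℕ → ℕ → ℕ → Bool
lollipopAdj r i j =
  (suc i ≡ᵇ j) ∨ (suc j ≡ᵇ i) ∨ ((i ≡ᵇ 0) ∧ (suc j ≡ᵇ r)) ∨ ((j ≡ᵇ 0) ∧ (suc i ≡ᵇ r))

lollipop : (n r : ℕ) → Graph n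
lollipop n r = record { adj = λ u v → lollipopAdj r (toℕ u) (toℕ v) }

module Submission where

-- Any function δ that vanishes exactly on the diagonal, grows by at most one
--    along edges and decreases along some edge into every vertex at positive distance (a
--    "breadth-first distance") equals Defs.dist.  For the lollipop the explicit candidate is the
--    shortest of the direct route |x − y| and the two routes through the closing edge {0, c}.
--  * Column sums.  W is the sum over y of column(y) = ∑_{x<y} d(x, y).  On the cycle, column(y)
--    only involves the cycle distance min(k, r − k); on the path, column(y+1) = column(y) + y + 1.
--  * Arithmetic.  For r = 2m this gives W(C_{2m}) = m³ and closed forms for the path columns,
--    hence an identity between natural-number polynomials, which rearranges to the statement in ℤ.

open import Defs
open import Data.Nat using (ℕ; _≤_; _<_)

module FiniteSums where

  open import Data.Bool using (true; false; T; if_then_else_)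
  open import Data.Bool.Properties using (T-≡)
  open import Data.Unit using (tt)
  open import Function.Bundles using (Equivalence)
  open import Relation.Nullary using (contradiction)
  open import Data.Nat using (ℕ; zero; suc; _+_; _∸_; _≤_; _<_; _<ᵇ_)
  open import Data.Nat.Properties
  open import Data.Nat.ListAction using (sum)
  open import Data.Nat.Tactic.RingSolver using (solve-∀)
  open import Data.Fin using (Fin; toℕ)
  import Data.Fin as Fin
  open import Data.List using (map; allFin; tabulate)
  open import Data.List.Properties using (map-tabulate)
  open import Data.Product using (_,_)
  open import Relation.Binary.PropositionalEquality
  open ≡-Reasoning

  ∑ : ℕ → (ℕ → ℕ) → ℕ
  ∑ zero    f = 0
  ∑ (suc n) f = ∑ n f + f n

  ∑-front : ∀ n f → ∑ (suc n) f ≡ f 0 + ∑ n (λ i → f (suc i))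
  ∑-front zero    f = +-comm 0 (f 0)
  ∑-front (suc n) f = begin
    ∑ (suc n) f + f (suc n)                  ≡⟨ cong (_+ f (suc n)) (∑-front n f) ⟩
    f 0 + ∑ n (λ i → f (suc i)) + f (suc n)  ≡⟨ +-assoc (f 0) _ _ ⟩
    f 0 + ∑ (suc n) (λ i → f (suc i))        ∎

  ∑-cong : ∀ n {f g} → (∀ i → i < n → f i ≡ g i) → ∑ n f ≡ ∑ n g
  ∑-cong zero    f≗g = refl
  ∑-cong (suc n) f≗g = cong₂ _+_ (∑-cong n (λ i i<n → f≗g i (m<n⇒m<1+n i<n))) (f≗g n ≤-refl)

  ∑-zero : ∀ n → ∑ n (λ _ → 0) ≡ 0
  ∑-zero zero    = refl
  ∑-zero (suc n) = trans (+-identityʳ _) (∑-zero n)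

  ∑-+ : ∀ n f g → ∑ n (λ i → f i + g i) ≡ ∑ n f + ∑ n g
  ∑-+ zero    f g = refl
  ∑-+ (suc n) f g = begin
    ∑ n (λ i → f i + g i) + (f n + g n)  ≡⟨ cong (_+ (f n + g n)) (∑-+ n f g) ⟩
    ∑ n f + ∑ n g + (f n + g n)          ≡⟨ interchange (∑ n f) (∑ n g) (f n) (g n) ⟩
    ∑ n f + f n + (∑ n g + g n)          ∎
    where
    interchange : ∀ a b c d → a + b + (c + d) ≡ a + c + (b + d)
    interchange = solve-∀

  ∑-suc : ∀ n f → ∑ n (λ i → suc (f i)) ≡ ∑ n f + n
  ∑-suc zero    f = refl
  ∑-suc (suc n) f = begin
    ∑ n (λ i → suc (f i)) + suc (f n)  ≡⟨ cong (_+ suc (f n)) (∑-suc n f) ⟩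
    ∑ n f + n + suc (f n)              ≡⟨ shuffle (∑ n f) n (f n) ⟩
    ∑ n f + f n + suc n                ∎
    where
    shuffle : ∀ a b c → a + b + suc c ≡ a + c + suc b
    shuffle = solve-∀

  ∑-split : ∀ b a f → ∑ (b + a) f ≡ ∑ a f + ∑ b (λ s → f (s + a))
  ∑-split zero    a f = sym (+-identityʳ _)
  ∑-split (suc b) a f = begin
    ∑ (b + a) f + f (b + a)                        ≡⟨ cong (_+ f (b + a)) (∑-split b a f) ⟩
    ∑ a f + ∑ b (λ s → f (s + a)) + f (b + a)      ≡⟨ +-assoc (∑ a f) _ _ ⟩
    ∑ a f + ∑ (suc b) (λ s → f (s + a))            ∎

  ∑-reverse : ∀ y (h : ℕ → ℕ) → ∑ y (λ x → h (y ∸ x)) ≡ ∑ y (λ k → h (suc k))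
  ∑-reverse zero    h = refl
  ∑-reverse (suc y) h = begin
    ∑ (suc y) (λ x → h (suc y ∸ x))        ≡⟨ ∑-front y (λ x → h (suc y ∸ x)) ⟩
    h (suc y) + ∑ y (λ x → h (y ∸ x))      ≡⟨ cong (h (suc y) +_) (∑-reverse y h) ⟩
    h (suc y) + ∑ y (λ k → h (suc k))      ≡⟨ +-comm (h (suc y)) _ ⟩
    ∑ (suc y) (λ k → h (suc k))            ∎

  ∑-comm : ∀ m n (F : ℕ → ℕ → ℕ) → ∑ m (λ x → ∑ n (F x)) ≡ ∑ n (λ y → ∑ m (λ x → F x y))
  ∑-comm zero    n F = sym (∑-zero n)
  ∑-comm (suc m) n F = begin
    ∑ m (λ x → ∑ n (F x)) + ∑ n (F m)                    ≡⟨ cong (_+ ∑ n (F m)) (∑-comm m n F) ⟩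
    ∑ n (λ y → ∑ m (λ x → F x y)) + ∑ n (F m)            ≡⟨ sym (∑-+ n _ (F m)) ⟩
    ∑ n (λ y → ∑ (suc m) (λ x → F x y))                  ∎

  <ᵇ-true : ∀ {x y} → x < y → (x <ᵇ y) ≡ true
  <ᵇ-true x<y = Equivalence.to T-≡ (<⇒<ᵇ x<y)

  <ᵇ-false : ∀ {x y} → y ≤ x → (x <ᵇ y) ≡ false
  <ᵇ-false {x} {y} y≤x with x <ᵇ y in eq
  ... | false = refl
  ... | true  = contradiction (<ᵇ⇒< x y (subst T (sym eq) tt)) (≤⇒≯ y≤x)

  ∑-below : ∀ n y f → y ≤ n → ∑ n (λ x → if x <ᵇ y then f x else 0) ≡ ∑ y f
  ∑-below n y f y≤n with m≤n⇒∃[o]m+o≡n y≤n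
  ... | k , refl = begin
    ∑ (y + k) g                        ≡⟨ cong (λ l → ∑ l g) (+-comm y k) ⟩
    ∑ (k + y) g                        ≡⟨ ∑-split k y g ⟩
    ∑ y g + ∑ k (λ s → g (s + y))      ≡⟨ cong₂ _+_ (∑-cong y below) (trans (∑-cong k above) (∑-zero k)) ⟩
    ∑ y f + 0                          ≡⟨ +-identityʳ _ ⟩
    ∑ y f                              ∎
    where
    g : ℕ → ℕ
    g x = if x <ᵇ y then f x else 0
    below : ∀ x → x < y → g x ≡ f x
    below x x<y rewrite <ᵇ-true x<y = refl
    above : ∀ s → s < k → g (s + y) ≡ 0
    above s _ rewrite <ᵇ-false (m≤n+m y s) = refl

  ∑-pairs : ∀ n (F : ℕ → ℕ → ℕ) →
    ∑ n (λ x → ∑ n (λ y → if x <ᵇ y then F x y else 0)) ≡ ∑ n (λ y → ∑ y (λ x → F x y))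
  ∑-pairs n F = trans (∑-comm n n _) (∑-cong n (λ y y<n → ∑-below n y (λ x → F x y) (<⇒≤ y<n)))

  sum-allFin : ∀ n (f : Fin n → ℕ) g → (∀ i → f i ≡ g (toℕ i)) → sum (map f (allFin n)) ≡ ∑ n g
  sum-allFin n f g f≗g = trans (cong sum (map-tabulate {n = n} (λ i → i) f)) (sum-tabulate n f g f≗g)
    where
    sum-tabulate : ∀ n (f : Fin n → ℕ) g → (∀ i → f i ≡ g (toℕ i)) → sum (tabulate f) ≡ ∑ n g
    sum-tabulate zero    f g f≗g = refl
    sum-tabulate (suc n) f g f≗g = begin
      f Fin.zero + sum (tabulate (λ i → f (Fin.suc i)))  ≡⟨ cong₂ _+_ (f≗g Fin.zero) (sum-tabulate n _ _ (λ i → f≗g (Fin.suc i))) ⟩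
      g 0 + ∑ n (λ i → g (suc i))                        ≡⟨ sym (∑-front n g) ⟩
      ∑ (suc n) g                                        ∎

module BreadthFirstDistance where

  open FiniteSums
  open import Data.Bool using (Bool; true; false; T; _∧_; if_then_else_)
  open import Data.Bool.Properties using (T-∨; T-∧)
  open import Data.Nat using (ℕ; zero; suc; _+_; _≤_; _<_; _<ᵇ_; z≤n; s≤s)
  open import Data.Nat.Properties
  open import Data.Fin using (Fin; toℕ)
  open import Data.Fin.Properties using (toℕ-injective)
  open import Data.List using (allFin)
  open import Data.List.Membership.Propositional using (lose)
  open import Data.List.Membership.Propositional.Properties using (∈-allFin)
  open import Data.List.Relation.Unary.Any using (satisfied)
  open import Data.List.Relation.Unary.Any.Properties using (any⁺; any⁻)
  open import Data.Product using (∃-syntax; _×_; _,_)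
  open import Data.Sum using (inj₁; inj₂)
  open import Data.Unit using (tt)
  open import Function.Bundles using (_⇔_; mk⇔; Equivalence)
  open import Relation.Nullary using (yes; no; contradiction)
  open import Relation.Binary.PropositionalEquality

  open Equivalence

  record IsBFSDistance {n} (G : Graph n) (δ : Fin n → Fin n → ℕ) : Set where
    field
      δ-diagonal   : ∀ u → δ u u ≡ 0
      δ-zero       : ∀ u v → δ u v ≡ 0 → u ≡ v
      δ-edge       : ∀ u w v → T (adj G w v) → δ u v ≤ suc (δ u w)
      δ-predecessor : ∀ u v m → δ u v ≡ suc m → ∃[ w ] T (adj G w v) × δ u w ≤ m
      δ-bounded    : ∀ u v → δ u v < n

  module _ {n} {G : Graph n} {δ : Fin n → Fin n → ℕ} (isBFS : IsBFSDistance G δ) where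
    open IsBFSDistance isBFS

    reach⇔δ≤ : ∀ k u v → T (reach G k u v) ⇔ δ u v ≤ k
    reach⇔δ≤ zero u v = mk⇔
      (λ u≡ᵇv → ≤-reflexive (trans (cong (δ u) (sym (toℕ-injective (≡ᵇ⇒≡ _ _ u≡ᵇv)))) (δ-diagonal u)))
      (λ δ≤0 → ≡⇒≡ᵇ _ _ (cong toℕ (δ-zero u v (n≤0⇒n≡0 δ≤0))))
    reach⇔δ≤ (suc k) u v = mk⇔ sound complete
      where
      step : Fin n → Bool
      step w = reach G k u w ∧ adj G w v

      sound : T (reach G (suc k) u v) → δ u v ≤ suc k
      sound h with to T-∨ h
      ... | inj₁ near = m≤n⇒m≤1+n (to (reach⇔δ≤ k u v) near)
      ... | inj₂ far with satisfied (any⁻ step (allFin n) far)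
      ... | w , uw∧wv with to T-∧ uw∧wv
      ... | uw , wv = ≤-trans (δ-edge u w v wv) (s≤s (to (reach⇔δ≤ k u w) uw))

      complete : δ u v ≤ suc k → T (reach G (suc k) u v)
      complete δ≤ with δ u v ≤? k
      ... | yes δ≤k = from T-∨ (inj₁ (from (reach⇔δ≤ k u v) δ≤k))
      ... | no δ≰k with δ-predecessor u v k (≤-antisym δ≤ (≰⇒> δ≰k))
      ... | w , wv , δw≤k = from T-∨ (inj₂ (any⁺ step (lose (∈-allFin w)
                              (from T-∧ (from (reach⇔δ≤ k u w) δw≤k , wv)))))

    firstReach≡δ : ∀ u v fuel k → k ≤ δ u v → δ u v < k + fuel → firstReach G u v k fuel ≡ δ u v
    firstReach≡δ u v zero k k≤δ δ<k+0 =
      contradiction (subst (δ u v <_) (+-identityʳ k) δ<k+0) (≤⇒≯ k≤δ)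
    firstReach≡δ u v (suc fuel) k k≤δ δ<k+fuel with reach G k u v in eq
    ... | true  = ≤-antisym k≤δ (to (reach⇔δ≤ k u v) (subst T (sym eq) tt))
    ... | false = firstReach≡δ u v fuel (suc k)
                    (≰⇒> (λ δ≤k → subst T eq (from (reach⇔δ≤ k u v) δ≤k)))
                    (subst (δ u v <_) (+-suc k fuel) δ<k+fuel)

    dist≡δ : ∀ u v → dist G u v ≡ δ u v
    dist≡δ u v = firstReach≡δ u v n 0 z≤n (δ-bounded u v)

  wiener≡∑columns : ∀ {n} (G : Graph n) (d : ℕ → ℕ → ℕ) → (∀ u v → dist G u v ≡ d (toℕ u) (toℕ v)) →
    wiener G ≡ ∑ n (λ y → ∑ y (λ x → d x y))
  wiener≡∑columns {n} G d dist≡d = trans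
    (sum-allFin n _ _ (λ u → sum-allFin n _ _ (λ v → cong (if toℕ u <ᵇ toℕ v then_else 0) (dist≡d u v))))
    (∑-pairs n d)

module LollipopDistance where

  open FiniteSums
  open BreadthFirstDistance
  open import Data.Bool using (T; false; _∨_; _∧_)
  open import Function.Base using (_∘_)
  open import Data.Bool.Properties using (T-∨; T-∧)
  open import Data.Nat using (ℕ; zero; suc; _+_; _∸_; _≤_; _<_; _≡ᵇ_; _⊓_; ∣_-_∣; z≤n; s≤s)
  open import Data.Nat.Properties
  open import Data.Fin using (toℕ; fromℕ<)
  open import Data.Fin.Properties using (toℕ<n; toℕ-fromℕ<; toℕ-injective)
  open import Data.Product using (∃-syntax; _×_; _,_)
  open import Data.Sum using (inj₁; inj₂)
  open import Function.Bundles using (Equivalence)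
  open import Relation.Binary.Definitions using (tri<; tri≈; tri>)
  open import Relation.Nullary using (yes; no; contradiction)
  open import Relation.Binary.PropositionalEquality
  open import Data.Nat.Tactic.RingSolver using (solve-∀)
  open ≡-Reasoning

  open Equivalence

  -- Throughout, c + 1 is the cycle length: the cycle is 0, 1, …, c and the path leaves it at c.

  data Edge (c : ℕ) : ℕ → ℕ → Set where
    up     : ∀ i → Edge c i (suc i)
    down   : ∀ i → Edge c (suc i) i
    close  : Edge c 0 c
    close′ : Edge c c 0

  -- Boolean equality is reflexive (it does not reduce on a variable).
  ≡ᵇ-refl : ∀ k → T (k ≡ᵇ k)
  ≡ᵇ-refl k = ≡⇒≡ᵇ k k refl

  adj⇒Edge : ∀ c i j → T (lollipopAdj (suc c) i j) → Edge c i j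
  adj⇒Edge c i j h with to T-∨ h
  ... | inj₁ e with ≡ᵇ⇒≡ (suc i) j e
  ...   | refl = up i
  adj⇒Edge c i j h | inj₂ h′ with to T-∨ h′
  ... | inj₁ e with ≡ᵇ⇒≡ (suc j) i e
  ...   | refl = down j
  adj⇒Edge c i j h | inj₂ h′ | inj₂ h″ with to T-∨ h″
  ... | inj₁ e with to T-∧ e
  ...   | i≡0 , j≡c with ≡ᵇ⇒≡ i 0 i≡0 | suc-injective (≡ᵇ⇒≡ (suc j) (suc c) j≡c)
  ...     | refl | refl = close
  adj⇒Edge c i j h | inj₂ h′ | inj₂ h″ | inj₂ e with to T-∧ e
  ...   | j≡0 , i≡c with ≡ᵇ⇒≡ j 0 j≡0 | suc-injective (≡ᵇ⇒≡ (suc i) (suc c) i≡c)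
  ...     | refl | refl = close′

  -- Introducing a disjunction; the left disjunct is named since T is not injective.
  T-∨ˡ : ∀ a {b} → T a → T (a ∨ b)
  T-∨ˡ a = from (T-∨ {a}) ∘ inj₁

  T-∨ʳ : ∀ a {b} → T b → T (a ∨ b)
  T-∨ʳ a = from (T-∨ {a}) ∘ inj₂

  Edge⇒adj : ∀ {c i j} → Edge c i j → T (lollipopAdj (suc c) i j)
  Edge⇒adj (up i)     = T-∨ˡ (suc i ≡ᵇ suc i) (≡ᵇ-refl i)
  Edge⇒adj (down i)   = T-∨ʳ (suc (suc i) ≡ᵇ i) (T-∨ˡ (suc i ≡ᵇ suc i) (≡ᵇ-refl i))
  Edge⇒adj {c} close  = T-∨ʳ (1 ≡ᵇ c) (T-∨ʳ false (T-∨ˡ (c ≡ᵇ c) (≡ᵇ-refl c)))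
  Edge⇒adj {c} close′ = T-∨ʳ (suc c ≡ᵇ 0) (T-∨ʳ (1 ≡ᵇ c) (T-∨ʳ ((c ≡ᵇ 0) ∧ (1 ≡ᵇ suc c)) (≡ᵇ-refl c)))

  -- The route from x down to 0, across the closing edge {0, c}, then along the labels to y.
  via : ℕ → ℕ → ℕ → ℕ
  via c x y = x + suc ∣ c - y ∣

  ldist : ℕ → ℕ → ℕ → ℕ
  ldist c x y = ∣ x - y ∣ ⊓ via c x y ⊓ via c y x

  ldist≤direct : ∀ c x y → ldist c x y ≤ ∣ x - y ∣
  ldist≤direct c x y = ≤-trans (m⊓n≤m _ _) (m⊓n≤m _ _)

  ldist≤via : ∀ c x y → ldist c x y ≤ via c x y
  ldist≤via c x y = ≤-trans (m⊓n≤m _ _) (m⊓n≤n _ _)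

  ldist≤via′ : ∀ c x y → ldist c x y ≤ via c y x
  ldist≤via′ c x y = m⊓n≤n _ _

  ∣m-1+n∣≡1+∣m-n∣ : ∀ {m n} → m ≤ n → ∣ m - suc n ∣ ≡ suc ∣ m - n ∣
  ∣m-1+n∣≡1+∣m-n∣ {zero}  {n}     m≤n       = refl
  ∣m-1+n∣≡1+∣m-n∣ {suc m} {suc n} (s≤s m≤n) = ∣m-1+n∣≡1+∣m-n∣ m≤n

  ∣m-n∣≡1+∣m-1+n∣ : ∀ {m n} → n < m → ∣ m - n ∣ ≡ suc ∣ m - suc n ∣
  ∣m-n∣≡1+∣m-1+n∣ {suc m} {zero}  _         = cong suc (sym (∣-∣-identityʳ m))
  ∣m-n∣≡1+∣m-1+n∣ {suc m} {suc n} (s≤s n<m) = ∣m-n∣≡1+∣m-1+n∣ n<m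

  ∣n-1+n∣≡1 : ∀ n → ∣ n - suc n ∣ ≡ 1
  ∣n-1+n∣≡1 n = trans (∣m-1+n∣≡1+∣m-n∣ (≤-refl {n})) (cong suc (∣n-n∣≡0 n))

  ldist-diagonal : ∀ c x → ldist c x x ≡ 0
  ldist-diagonal c x = n≤0⇒n≡0 (≤-trans (ldist≤direct c x x) (≤-reflexive (∣n-n∣≡0 x)))

  -- The routes through {0, c} have positive length, so only equal labels are at distance 0.
  ldist-zero : ∀ c x y → ldist c x y ≡ 0 → x ≡ y
  ldist-zero c x y d≡0 with x ≟ y
  ... | yes x≡y = x≡y
  ... | no  x≢y = contradiction d≡0 (≢-sym (<⇒≢ (⊓-glb (⊓-glb direct>0 (via>0 x y)) (via>0 y x))))
    where
    direct>0 : 0 < ∣ x - y ∣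
    direct>0 = n≢0⇒n>0 (x≢y ∘ ∣m-n∣≡0⇒m≡n)
    via>0 : ∀ x y → 0 < via c x y
    via>0 x y = ≤-trans (s≤s z≤n) (m≤n+m _ x)

  ldist-bounded : ∀ c {n x y} → x < n → y < n → ldist c x y < n
  ldist-bounded c {x = x} {y} x<n y<n =
    ≤-<-trans (ldist≤direct c x y) (≤-<-trans (∣m-n∣≤m⊔n x y) (⊔-lub x<n y<n))

  -- Between neighbouring labels each of the three routes lengthens by at most one.
  ldist-lipschitz : ∀ c x {w v} → ∣ w - v ∣ ≤ 1 → ldist c x v ≤ suc (ldist c x w)
  ldist-lipschitz c x {w} {v} w~v = ⊓-mono-≤ (⊓-mono-≤ (shift x) viaˡ) viaʳ
    where
    shift : ∀ a → ∣ a - v ∣ ≤ suc ∣ a - w ∣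
    shift a = ≤-trans (∣-∣-triangle a w v) (≤-trans (+-monoʳ-≤ ∣ a - w ∣ w~v) (≤-reflexive (+-comm _ 1)))
    viaˡ : via c x v ≤ suc (via c x w)
    viaˡ = ≤-trans (+-monoʳ-≤ x (s≤s (shift c))) (≤-reflexive (+-suc x _))
    v≤1+w : v ≤ suc w
    v≤1+w = ≤-trans (m≤n+∣m-n∣ v w) (≤-trans (+-monoʳ-≤ w (≤-trans (≤-reflexive (∣-∣-comm v w)) w~v))
                                            (≤-reflexive (+-comm w 1)))
    viaʳ : via c v x ≤ suc (via c w x)
    viaʳ = +-monoˡ-≤ (suc ∣ c - x ∣) v≤1+w

  -- Crossing an edge increases the distance from x by at most one.  For the closing edge we use
  -- that suc (a ⊓ b ⊓ e) reduces to suc a ⊓ suc b ⊓ suc e, and bound each of the three terms.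
  ldist-edge : ∀ c x {w v} → Edge c w v → ldist c x v ≤ suc (ldist c x w)
  ldist-edge c x (up i)   = ldist-lipschitz c x (≤-reflexive (∣n-1+n∣≡1 i))
  ldist-edge c x (down i) = ldist-lipschitz c x (≤-reflexive (trans (∣-∣-comm (suc i) i) (∣n-1+n∣≡1 i)))
  ldist-edge c x close    = ⊓-glb (⊓-glb
    (≤-trans x→c (≤-reflexive (cong suc (sym (∣-∣-identityʳ x)))))
    (≤-trans x→c (s≤s (m≤m+n x _))))
    (≤-trans (ldist≤direct c x c) (≤-trans (≤-reflexive (∣-∣-comm x c)) (≤-trans (n≤1+n _) (n≤1+n _))))
    where
    x→c : ldist c x c ≤ suc x
    x→c = ≤-trans (ldist≤via c x c) (≤-reflexive (trans (cong (λ k → x + suc k) (∣n-n∣≡0 c)) (+-comm x 1)))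
  ldist-edge c x close′   = ⊓-glb (⊓-glb
    (≤-trans (ldist≤via′ c x 0) (≤-reflexive (cong suc (∣-∣-comm c x))))
    (≤-trans x→0 (≤-trans (m≤m+n x _) (n≤1+n _))))
    (≤-trans x→0 (≤-trans (m≤n+∣m-n∣ x c) (≤-trans (+-monoʳ-≤ c (≤-reflexive (∣-∣-comm x c)))
                                                   (≤-trans (+-monoʳ-≤ c (n≤1+n _)) (n≤1+n _)))))
    where
    x→0 : ldist c x 0 ≤ x
    x→0 = ≤-trans (ldist≤direct c x 0) (≤-reflexive (∣-∣-identityʳ x))

  Predecessor : ℕ → ℕ → ℕ → ℕ → ℕ → Set
  Predecessor c n x v m = ∃[ w ] w < n × Edge c w v × ldist c x w ≤ m

  -- If the direct route realises a positive distance, step one label towards x.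
  direct-predecessor : ∀ c {n x v m} → x < n → v < n → ∣ x - v ∣ ≡ suc m → Predecessor c n x v m
  direct-predecessor c {x = x} {v} x<n v<n e with <-cmp x v
  direct-predecessor c {x = x} {suc v} x<n v<n e | tri< (s≤s x≤v) _ _ =
    v , <-trans (n<1+n v) v<n , up v ,
    ≤-trans (ldist≤direct c x v) (≤-reflexive (suc-injective (trans (sym (∣m-1+n∣≡1+∣m-n∣ x≤v)) e)))
  ... | tri≈ _ refl _ = contradiction (trans (sym (∣n-n∣≡0 x)) e) 0≢1+n
  ... | tri> _ _ v<x  = suc v , ≤-<-trans v<x x<n , down v ,
    ≤-trans (ldist≤direct c x (suc v)) (≤-reflexive (suc-injective (trans (sym (∣m-n∣≡1+∣m-1+n∣ v<x)) e)))

  -- If the route x ⇝ 0 — c ⇝ v realises it, step one label towards c (or to 0 when v = c).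
  via-predecessor : ∀ c {n x v m} → c < n → v < n → x + ∣ c - v ∣ ≡ m → Predecessor c n x v m
  via-predecessor c {x = x} {v} c<n v<n e with <-cmp v c
  ... | tri< v<c _ _ = suc v , ≤-<-trans v<c c<n , down v ,
    ≤-trans (ldist≤via c x (suc v)) (≤-reflexive (trans (cong (x +_) (sym (∣m-n∣≡1+∣m-1+n∣ v<c))) e))
  via-predecessor c {x = x} {.c} c<n v<n e | tri≈ _ refl _ = 0 , ≤-<-trans z≤n c<n , close ,
    ≤-trans (ldist≤direct c x 0)
      (≤-reflexive (trans (∣-∣-identityʳ x) (trans (sym (+-identityʳ x)) (trans (cong (x +_) (sym (∣n-n∣≡0 c))) e))))
  via-predecessor c {x = x} {suc v} c<n v<n e | tri> _ _ (s≤s c≤v) = v , <-trans (n<1+n v) v<n , up v ,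
    ≤-trans (ldist≤via c x v) (≤-reflexive (trans (cong (x +_) (sym (∣m-1+n∣≡1+∣m-n∣ c≤v))) e))

  -- If the route v ⇝ 0 — c ⇝ x realises it, step one label towards 0 (or to c when v = 0).
  via′-predecessor : ∀ c {n x v m} → c < n → v < n → v + suc ∣ c - x ∣ ≡ suc m → Predecessor c n x v m
  via′-predecessor c {x = x} {zero}  c<n v<n e = c , c<n , close′ ,
    ≤-trans (ldist≤direct c x c) (≤-reflexive (trans (∣-∣-comm x c) (suc-injective e)))
  via′-predecessor c {x = x} {suc v} c<n v<n e = v , <-trans (n<1+n v) v<n , up v ,
    ≤-trans (ldist≤via′ c x v) (≤-reflexive (suc-injective e))

  -- Every positive distance is realised by one of the three routes, which yields a predecessor.
  ldist-predecessor : ∀ c {n x v m} → x < n → v < n → c < n → ldist c x v ≡ suc m → Predecessor c n x v m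
  ldist-predecessor c {x = x} {v} x<n v<n c<n e with ⊓-sel (∣ x - v ∣ ⊓ via c x v) (via c v x)
  ... | inj₂ e₃ = via′-predecessor c c<n v<n (trans (sym e₃) e)
  ... | inj₁ e₁₂ with ⊓-sel ∣ x - v ∣ (via c x v)
  ...   | inj₁ e₁ = direct-predecessor c x<n v<n (trans (sym e₁) (trans (sym e₁₂) e))
  ...   | inj₂ e₂ = via-predecessor c c<n v<n
                      (suc-injective (trans (sym (+-suc x _)) (trans (sym e₂) (trans (sym e₁₂) e))))

  lollipop-isBFS : ∀ {n} c → c < n → IsBFSDistance (lollipop n (suc c)) (λ u v → ldist c (toℕ u) (toℕ v))
  lollipop-isBFS {n} c c<n = record
    { δ-diagonal    = λ u → ldist-diagonal c (toℕ u)
    ; δ-zero        = λ u v d≡0 → toℕ-injective (ldist-zero c _ _ d≡0)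
    ; δ-edge        = λ u w v wv → ldist-edge c (toℕ u) (adj⇒Edge c _ _ wv)
    ; δ-predecessor = λ u v m d≡1+m → onFin (ldist-predecessor c (toℕ<n u) (toℕ<n v) c<n d≡1+m)
    ; δ-bounded     = λ u v → ldist-bounded c (toℕ<n u) (toℕ<n v)
    }
    where
    onFin : ∀ {u v m} → Predecessor c n (toℕ u) (toℕ v) m →
            ∃[ w ] T (lollipopAdj (suc c) (toℕ w) (toℕ v)) × ldist c (toℕ u) (toℕ w) ≤ m
    onFin (w , w<n , wv , d≤m) rewrite sym (toℕ-fromℕ< w<n) =
      fromℕ< w<n , Edge⇒adj wv , d≤m

  -- For x ≤ y the route y ⇝ 0 — c ⇝ x is never shorter than the direct one.
  ldist-ordered : ∀ c {x y} → x ≤ y → ldist c x y ≡ (y ∸ x) ⊓ via c x y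
  ldist-ordered c {x} {y} x≤y = begin
    ∣ x - y ∣ ⊓ via c x y ⊓ via c y x  ≡⟨ m≤n⇒m⊓n≡m (≤-trans (m⊓n≤m _ _) direct≤via′) ⟩
    ∣ x - y ∣ ⊓ via c x y              ≡⟨ cong (_⊓ via c x y) (m≤n⇒∣m-n∣≡n∸m x≤y) ⟩
    (y ∸ x) ⊓ via c x y                ∎
    where
    direct≤via′ : ∣ x - y ∣ ≤ via c y x
    direct≤via′ = ≤-trans (≤-reflexive (m≤n⇒∣m-n∣≡n∸m x≤y)) (≤-trans (m∸n≤m y x) (m≤m+n y _))

  -- Distance in the cycle C_r between two vertices whose labels differ by k ≤ r.
  cycleDist : ℕ → ℕ → ℕ
  cycleDist r k = k ⊓ (r ∸ k)

  cycleColumn : ℕ → ℕ → ℕ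
  cycleColumn r y = ∑ y (λ k → cycleDist r (suc k))

  ldist-cycle : ∀ c {x y} → x ≤ y → y ≤ c → ldist c x y ≡ cycleDist (suc c) (y ∸ x)
  ldist-cycle c {x} {y} x≤y y≤c with m≤n⇒∃[o]m+o≡n x≤y | m≤n⇒∃[o]m+o≡n y≤c
  ... | b , refl | a , refl = trans (ldist-ordered c x≤y) (cong ((x + b ∸ x) ⊓_) around)
    where
    around : via (x + b + a) x (x + b) ≡ suc (x + b + a) ∸ (x + b ∸ x)
    around = begin
      x + suc ∣ x + b + a - (x + b) ∣  ≡⟨ cong (λ k → x + suc k) (trans (∣-∣-comm (x + b + a) (x + b)) (∣m-m+n∣≡n (x + b) a)) ⟩
      x + suc a                        ≡⟨ sym (m+n∸n≡m (x + suc a) b) ⟩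
      x + suc a + b ∸ b                ≡⟨ cong₂ _∸_ (reorder x b a) (sym (m+n∸m≡n x b)) ⟩
      suc (x + b + a) ∸ (x + b ∸ x)    ∎
      where
      reorder : ∀ x b a → x + suc a + b ≡ suc (x + b + a)
      reorder = solve-∀

  ldist-tail : ∀ c {x y} → x ≤ y → c ≤ y → ldist c x (suc y) ≡ suc (ldist c x y)
  ldist-tail c {x} {y} x≤y c≤y = begin
    ldist c x (suc y)                  ≡⟨ ldist-ordered c (m≤n⇒m≤1+n x≤y) ⟩
    (suc y ∸ x) ⊓ via c x (suc y)      ≡⟨ cong₂ _⊓_ (+-∸-assoc 1 x≤y) further ⟩
    suc ((y ∸ x) ⊓ via c x y)          ≡⟨ cong suc (sym (ldist-ordered c x≤y)) ⟩
    suc (ldist c x y)                  ∎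
    where
    further : via c x (suc y) ≡ suc (via c x y)
    further = trans (cong (λ k → x + suc k) (∣m-1+n∣≡1+∣m-n∣ c≤y)) (+-suc x _)

  column : ℕ → ℕ → ℕ
  column c y = ∑ y (λ x → ldist c x y)

  column-cycle : ∀ c y → y ≤ c → column c y ≡ cycleColumn (suc c) y
  column-cycle c y y≤c = trans (∑-cong y (λ x x<y → ldist-cycle c (<⇒≤ x<y) y≤c)) (∑-reverse y (cycleDist (suc c)))

  column-tail : ∀ c y → c ≤ y → column c (suc y) ≡ column c y + suc y
  column-tail c y c≤y = begin
    ∑ y (λ x → ldist c x (suc y)) + ldist c y (suc y)  ≡⟨ cong₂ _+_ (∑-cong y (λ x x<y → ldist-tail c (<⇒≤ x<y) c≤y)) neighbour ⟩
    ∑ y (λ x → suc (ldist c x y)) + 1                  ≡⟨ cong (_+ 1) (∑-suc y (λ x → ldist c x y)) ⟩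
    column c y + y + 1                                 ≡⟨ trans (+-assoc (column c y) y 1) (cong (column c y +_) (+-comm y 1)) ⟩
    column c y + suc y                                 ∎
    where
    neighbour : ldist c y (suc y) ≡ 1
    neighbour = trans (ldist-tail c ≤-refl c≤y) (cong suc (ldist-diagonal c y))

  wiener-lollipop : ∀ {n} c → c < n → wiener (lollipop n (suc c)) ≡ ∑ n (column c)
  wiener-lollipop c c<n = wiener≡∑columns _ (ldist c) (dist≡δ (lollipop-isBFS c c<n))

module EvenCycle where

  open FiniteSums
  open LollipopDistance
  open import Data.Nat using (ℕ; zero; suc; _+_; _*_; _∸_; _≤_; _⊓_)
  open import Data.Nat.Properties
  open import Data.Nat.Tactic.RingSolver using (solve-∀)
  open import Relation.Binary.PropositionalEquality
  open ≡-Reasoning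

  cycleDist-rise : ∀ m k → k ≤ m → cycleDist (m + m) k ≡ k
  cycleDist-rise m k k≤m =
    m≤n⇒m⊓n≡m (≤-trans k≤m (≤-trans (≤-reflexive (sym (m+n∸n≡m m m))) (∸-monoʳ-≤ (m + m) k≤m)))

  cycleDist-fall : ∀ m s → cycleDist (m + m) (suc s + m) ≡ m ∸ suc s
  cycleDist-fall m s =
    trans (cong (λ d → (suc s + m) ⊓ d) back) (m≥n⇒m⊓n≡n (≤-trans (m∸n≤m m (suc s)) (m≤n+m m (suc s))))
    where
    back : m + m ∸ (suc s + m) ≡ m ∸ suc s
    back = trans (cong (m + m ∸_) (+-comm (suc s) m)) ([m+n]∸[m+o]≡n∸o m m (suc s))

  cycleColumn-rise : ∀ m y → y ≤ m → 2 * cycleColumn (m + m) y ≡ y * suc y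
  cycleColumn-rise m zero    _   = refl
  cycleColumn-rise m (suc y) y<m = begin
    2 * (cycleColumn (m + m) y + cycleDist (m + m) (suc y))  ≡⟨ cong (λ d → 2 * (cycleColumn (m + m) y + d)) (cycleDist-rise m (suc y) y<m) ⟩
    2 * (cycleColumn (m + m) y + suc y)                      ≡⟨ *-distribˡ-+ 2 (cycleColumn (m + m) y) (suc y) ⟩
    2 * cycleColumn (m + m) y + 2 * suc y                    ≡⟨ cong (_+ 2 * suc y) (cycleColumn-rise m y (<⇒≤ y<m)) ⟩
    y * suc y + 2 * suc y                                    ≡⟨ triangle y ⟩
    suc y * suc (suc y)                                      ∎
    where
    triangle : ∀ y → y * suc y + 2 * suc y ≡ suc y * suc (suc y)
    triangle = solve-∀

  cycleColumn-fall : ∀ m s → s ≤ m → 2 * cycleColumn (m + m) (s + m) + s * suc s ≡ m * suc m + 2 * s * m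
  cycleColumn-fall m zero    _   = cong (_+ 0) (cycleColumn-rise m m ≤-refl)
  cycleColumn-fall m (suc s) s<m = begin
    2 * (C + d) + suc s * suc (suc s)          ≡⟨ regroup C d s ⟩
    (2 * C + s * suc s) + 2 * (d + suc s)      ≡⟨ cong₂ (λ a b → a + 2 * b) (cycleColumn-fall m s (<⇒≤ s<m)) d+1+s≡m ⟩
    (m * suc m + 2 * s * m) + 2 * m            ≡⟨ regroup′ m s ⟩
    m * suc m + 2 * suc s * m                  ∎
    where
    C d : ℕ
    C = cycleColumn (m + m) (s + m)
    d = cycleDist (m + m) (suc s + m)
    d+1+s≡m : d + suc s ≡ m
    d+1+s≡m = trans (cong (_+ suc s) (cycleDist-fall m s)) (m∸n+n≡m s<m)
    regroup : ∀ C d s → 2 * (C + d) + suc s * suc (suc s) ≡ (2 * C + s * suc s) + 2 * (d + suc s)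
    regroup = solve-∀
    regroup′ : ∀ m s → (m * suc m + 2 * s * m) + 2 * m ≡ m * suc m + 2 * suc s * m
    regroup′ = solve-∀

  ∑-rise : ∀ m t → t ≤ m → 6 * ∑ t (cycleColumn (m + m)) + t ≡ t * t * t
  ∑-rise m zero    _   = refl
  ∑-rise m (suc t) t<m = begin
    6 * (S + C) + suc t                 ≡⟨ regroup S C t ⟩
    (6 * S + t) + 3 * (2 * C) + 1       ≡⟨ cong₂ (λ a b → a + 3 * b + 1) (∑-rise m t (<⇒≤ t<m)) (cycleColumn-rise m t (<⇒≤ t<m)) ⟩
    t * t * t + 3 * (t * suc t) + 1     ≡⟨ cube t ⟩
    suc t * suc t * suc t               ∎
    where
    S C : ℕ
    S = ∑ t (cycleColumn (m + m))
    C = cycleColumn (m + m) t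
    regroup : ∀ S C t → 6 * (S + C) + suc t ≡ (6 * S + t) + 3 * (2 * C) + 1
    regroup = solve-∀
    cube : ∀ t → t * t * t + 3 * (t * suc t) + 1 ≡ suc t * suc t * suc t
    cube = solve-∀

  ∑-fall : ∀ m t → t ≤ m → 6 * ∑ t (λ s → cycleColumn (m + m) (s + m)) + t * t * t ≡ 3 * t * m * m + 3 * m * t * t + t
  ∑-fall m zero    _   = vanish m
    where
    vanish : ∀ m → 0 ≡ 3 * 0 * m * m + 3 * m * 0 * 0 + 0
    vanish = solve-∀
  ∑-fall m (suc t) t<m = begin
    6 * (S + C) + suc t * suc t * suc t                             ≡⟨ regroup S C t ⟩
    (6 * S + t * t * t) + 3 * (2 * C + t * suc t) + 1               ≡⟨ cong₂ (λ a b → a + 3 * b + 1) (∑-fall m t (<⇒≤ t<m)) (cycleColumn-fall m t (<⇒≤ t<m)) ⟩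
    (3 * t * m * m + 3 * m * t * t + t) + 3 * (m * suc m + 2 * t * m) + 1  ≡⟨ expand m t ⟩
    3 * suc t * m * m + 3 * m * suc t * suc t + suc t              ∎
    where
    S C : ℕ
    S = ∑ t (λ s → cycleColumn (m + m) (s + m))
    C = cycleColumn (m + m) (t + m)
    regroup : ∀ S C t → 6 * (S + C) + suc t * suc t * suc t ≡ (6 * S + t * t * t) + 3 * (2 * C + t * suc t) + 1
    regroup = solve-∀
    expand : ∀ m t → (3 * t * m * m + 3 * m * t * t + t) + 3 * (m * suc m + 2 * t * m) + 1
                   ≡ 3 * suc t * m * m + 3 * m * suc t * suc t + suc t
    expand = solve-∀

  cycleWiener : ∀ m → ∑ (m + m) (cycleColumn (m + m)) ≡ m * m * m
  cycleWiener m = *-cancelˡ-≡ _ _ 6 (+-cancelʳ-≡ (m + m * m * m) _ _ (begin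
    6 * ∑ (m + m) C + (m + m * m * m)          ≡⟨ cong (λ a → 6 * a + (m + m * m * m)) (∑-split m m C) ⟩
    6 * (A + B) + (m + m * m * m)              ≡⟨ regroup A B m ⟩
    (6 * A + m) + (6 * B + m * m * m)          ≡⟨ cong₂ _+_ (∑-rise m m ≤-refl) (∑-fall m m ≤-refl) ⟩
    m * m * m + (3 * m * m * m + 3 * m * m * m + m)  ≡⟨ collect m ⟩
    6 * (m * m * m) + (m + m * m * m)          ∎))
    where
    C : ℕ → ℕ
    C = cycleColumn (m + m)
    A B : ℕ
    A = ∑ m C
    B = ∑ m (λ s → C (s + m))
    regroup : ∀ A B m → 6 * (A + B) + (m + m * m * m) ≡ (6 * A + m) + (6 * B + m * m * m)
    regroup = solve-∀
    collect : ∀ m → m * m * m + (3 * m * m * m + 3 * m * m * m + m) ≡ 6 * (m * m * m) + (m + m * m * m)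
    collect = solve-∀

-- The lollipop L_{i+2m, 2m} with m = p + 1: cycle 0, …, c where c = 2m − 1 = p + m, then the path.
module EvenLollipop (p : ℕ) where

  open FiniteSums
  open LollipopDistance
  open EvenCycle
  open import Data.Nat using (ℕ; zero; suc; _+_; _*_; _≤_)
  open import Data.Nat.Properties
  open import Data.Nat.Tactic.RingSolver using (solve-∀)
  open import Relation.Binary.PropositionalEquality
  open ≡-Reasoning

  m c r : ℕ
  m = suc p
  c = p + m
  r = suc c

  column-junction : 2 * column c c ≡ 2 * m * m
  column-junction = +-cancelʳ-≡ (p * suc p) _ _ (begin
    2 * column c c + p * suc p               ≡⟨ cong (λ a → 2 * a + p * suc p) (column-cycle c c ≤-refl) ⟩
    2 * cycleColumn (m + m) (p + m) + p * suc p  ≡⟨ cycleColumn-fall m p (n≤1+n p) ⟩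
    m * suc m + 2 * p * m                    ≡⟨ square p ⟩
    2 * m * m + p * suc p                    ∎)
    where
    square : ∀ p → suc p * suc (suc p) + 2 * p * suc p ≡ 2 * suc p * suc p + p * suc p
    square = solve-∀

  column-step : ∀ y → c ≤ y → 2 * column c (suc y) ≡ 2 * column c y + 2 * suc y
  column-step y c≤y = trans (cong (2 *_) (column-tail c y c≤y)) (*-distribˡ-+ 2 (column c y) (suc y))

  column-path : ∀ j → 2 * column c (j + r) ≡ 2 * m * m + 2 * suc j * c + suc j * suc (suc j)
  column-path zero = begin
    2 * column c r                   ≡⟨ column-step c ≤-refl ⟩
    2 * column c c + 2 * r           ≡⟨ cong (_+ 2 * r) column-junction ⟩
    2 * m * m + 2 * suc c            ≡⟨ first m c ⟩
    2 * m * m + 2 * 1 * c + 1 * 2    ∎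
    where
    first : ∀ m c → 2 * m * m + 2 * suc c ≡ 2 * m * m + 2 * 1 * c + 1 * 2
    first = solve-∀
  column-path (suc j) = begin
    2 * column c (suc (j + r))                                          ≡⟨ column-step (j + r) (≤-trans (n≤1+n c) (m≤n+m r j)) ⟩
    2 * column c (j + r) + 2 * suc (j + r)                              ≡⟨ cong (_+ 2 * suc (j + r)) (column-path j) ⟩
    2 * m * m + 2 * suc j * c + suc j * suc (suc j) + 2 * suc (j + suc c)  ≡⟨ next m c j ⟩
    2 * m * m + 2 * suc (suc j) * c + suc (suc j) * suc (suc (suc j))   ∎
    where
    next : ∀ m c j → 2 * m * m + 2 * suc j * c + suc j * suc (suc j) + 2 * suc (j + suc c)
                   ≡ 2 * m * m + 2 * suc (suc j) * c + suc (suc j) * suc (suc (suc j))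
    next = solve-∀

  pathColumns : ℕ → ℕ
  pathColumns i = ∑ i (λ j → column c (j + r))

  -- Its closed form, via ∑_{k ≤ i} k(k+1) = i(i+1)(i+2)/3.
  ∑-path : ∀ i → 3 * (2 * pathColumns i) ≡ 6 * m * m * i + 3 * c * i * suc i + i * suc i * suc (suc i)
  ∑-path zero = vanish m c
    where
    vanish : ∀ m c → 0 ≡ 6 * m * m * 0 + 3 * c * 0 * 1 + 0
    vanish = solve-∀
  ∑-path (suc i) = begin
    3 * (2 * (S + C))              ≡⟨ distribute S C ⟩
    3 * (2 * S) + 3 * (2 * C)      ≡⟨ cong₂ (λ a b → a + 3 * b) (∑-path i) (column-path i) ⟩
    6 * m * m * i + 3 * c * i * suc i + i * suc i * suc (suc i) + 3 * (2 * m * m + 2 * suc i * c + suc i * suc (suc i))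
                                   ≡⟨ next m c i ⟩
    6 * m * m * suc i + 3 * c * suc i * suc (suc i) + suc i * suc (suc i) * suc (suc (suc i))  ∎
    where
    S C : ℕ
    S = pathColumns i
    C = column c (i + r)
    distribute : ∀ S C → 3 * (2 * (S + C)) ≡ 3 * (2 * S) + 3 * (2 * C)
    distribute = solve-∀
    next : ∀ m c i → 6 * m * m * i + 3 * c * i * suc i + i * suc i * suc (suc i) + 3 * (2 * m * m + 2 * suc i * c + suc i * suc (suc i))
                   ≡ 6 * m * m * suc i + 3 * c * suc i * suc (suc i) + suc i * suc (suc i) * suc (suc (suc i))
    next = solve-∀

  wiener-split : ∀ i → wiener (lollipop (i + r) r) ≡ m * m * m + pathColumns i
  wiener-split i = begin
    wiener (lollipop (i + r) r)                            ≡⟨ wiener-lollipop c (m≤n+m r i) ⟩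
    ∑ (i + r) (column c)                                   ≡⟨ ∑-split i r (column c) ⟩
    ∑ r (column c) + pathColumns i                         ≡⟨ cong (_+ pathColumns i) (trans (∑-cong r (λ y y<r → column-cycle c y (≤-pred y<r))) (cycleWiener m)) ⟩
    m * m * m + pathColumns i                              ∎

  wiener-even : ∀ i → let n = i + r in
    24 * wiener (lollipop n r) + (6 * r * r * n + 4 * n + 12 * r * r) ≡ 4 * n * n * n + 12 * r * n + 5 * r * r * r + 4 * r
  wiener-even i = begin
    24 * wiener (lollipop n r) + X                    ≡⟨ cong (λ w → 24 * w + X) (wiener-split i) ⟩
    24 * (m * m * m + T) + X                          ≡⟨ distribute (m * m * m) T X ⟩
    24 * (m * m * m) + 4 * (3 * (2 * T)) + X          ≡⟨ cong (λ t → 24 * (m * m * m) + 4 * t + X) (∑-path i) ⟩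
    24 * (m * m * m) + 4 * (6 * m * m * i + 3 * c * i * suc i + i * suc i * suc (suc i)) + X  ≡⟨ closed-form p i ⟩
    4 * n * n * n + 12 * r * n + 5 * r * r * r + 4 * r  ∎
    where
    n X T : ℕ
    n = i + r
    X = 6 * r * r * n + 4 * n + 12 * r * r
    T = pathColumns i
    distribute : ∀ M T X → 24 * (M + T) + X ≡ 24 * M + 4 * (3 * (2 * T)) + X
    distribute = solve-∀
    closed-form : ∀ p i →
      let m = suc p ; c = p + suc p ; r = suc p + suc p ; n = i + (suc p + suc p) in
      24 * (m * m * m) + 4 * (6 * m * m * i + 3 * c * i * suc i + i * suc i * suc (suc i)) + (6 * r * r * n + 4 * n + 12 * r * r)
        ≡ 4 * n * n * n + 12 * r * n + 5 * r * r * r + 4 * r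
    closed-form = solve-∀

module IntegerForm where

  import Data.Nat as ℕ
  open import Data.Nat using (ℕ)
  open import Data.Integer using (ℤ; +_; _+_; _-_; _*_)
  open import Data.Integer.Properties using (pos-+; pos-*)
  open import Data.Integer.Tactic.RingSolver using (solve-∀)
  open import Relation.Binary.PropositionalEquality

  pos-*³ : ∀ a b c → + (a ℕ.* b ℕ.* c) ≡ + a * + b * + c
  pos-*³ a b c = trans (pos-* (a ℕ.* b) c) (cong (_* + c) (pos-* a b))

  pos-*⁴ : ∀ a b c d → + (a ℕ.* b ℕ.* c ℕ.* d) ≡ + a * + b * + c * + d
  pos-*⁴ a b c d = trans (pos-* (a ℕ.* b ℕ.* c) d) (cong (_* + d) (pos-*³ a b c))

  -- The subtraction-free identity over ℕ, embedded in ℤ and rearranged, is the integer identity.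
  integer-form : ∀ W n r →
    24 ℕ.* W ℕ.+ (6 ℕ.* r ℕ.* r ℕ.* n ℕ.+ 4 ℕ.* n ℕ.+ 12 ℕ.* r ℕ.* r)
      ≡ 4 ℕ.* n ℕ.* n ℕ.* n ℕ.+ 12 ℕ.* r ℕ.* n ℕ.+ 5 ℕ.* r ℕ.* r ℕ.* r ℕ.+ 4 ℕ.* r →
    + 24 * + W
      ≡ + 4 * + n * + n * + n
        + (+ 12 * + r - + 6 * + r * + r - + 4) * + n
        + (+ 5 * + r * + r * + r - + 12 * + r * + r + + 4 * + r)
  integer-form W n r identity = begin
    + 24 * + W                         ≡⟨ add-sub (+ 24 * + W) X ⟩
    (+ 24 * + W + X) - X               ≡⟨ cong (_- X) (trans (sym lhs) (trans (cong +_ identity) rhs)) ⟩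
    Y - X                              ≡⟨ rearrange (+ n) (+ r) ⟩
    + 4 * + n * + n * + n + (+ 12 * + r - + 6 * + r * + r - + 4) * + n + (+ 5 * + r * + r * + r - + 12 * + r * + r + + 4 * + r)  ∎
    where
    open ≡-Reasoning
    X Y : ℤ
    X = + 6 * + r * + r * + n + + 4 * + n + + 12 * + r * + r
    Y = + 4 * + n * + n * + n + + 12 * + r * + n + + 5 * + r * + r * + r + + 4 * + r
    a₁ a₂ a₃ b₁ b₂ b₃ b₄ : ℕ
    a₁ = 6 ℕ.* r ℕ.* r ℕ.* n
    a₂ = 4 ℕ.* n
    a₃ = 12 ℕ.* r ℕ.* r
    b₁ = 4 ℕ.* n ℕ.* n ℕ.* n
    b₂ = 12 ℕ.* r ℕ.* n
    b₃ = 5 ℕ.* r ℕ.* r ℕ.* r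
    b₄ = 4 ℕ.* r
    lhs : + (24 ℕ.* W ℕ.+ (6 ℕ.* r ℕ.* r ℕ.* n ℕ.+ 4 ℕ.* n ℕ.+ 12 ℕ.* r ℕ.* r)) ≡ + 24 * + W + X
    lhs = trans (pos-+ (24 ℕ.* W) (a₁ ℕ.+ a₂ ℕ.+ a₃)) (cong₂ _+_ (pos-* 24 W)
            (trans (pos-+ (a₁ ℕ.+ a₂) a₃) (cong₂ _+_ (trans (pos-+ a₁ a₂) (cong₂ _+_ (pos-*⁴ 6 r r n) (pos-* 4 n)))
                                                     (pos-*³ 12 r r))))
    rhs : + (4 ℕ.* n ℕ.* n ℕ.* n ℕ.+ 12 ℕ.* r ℕ.* n ℕ.+ 5 ℕ.* r ℕ.* r ℕ.* r ℕ.+ 4 ℕ.* r) ≡ Y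
    rhs = trans (pos-+ (b₁ ℕ.+ b₂ ℕ.+ b₃) b₄) (cong₂ _+_
            (trans (pos-+ (b₁ ℕ.+ b₂) b₃) (cong₂ _+_ (trans (pos-+ b₁ b₂) (cong₂ _+_ (pos-*⁴ 4 n n n) (pos-*³ 12 r n)))
                                                     (pos-*⁴ 5 r r r)))
            (pos-* 4 r))
    add-sub : ∀ a b → a ≡ (a + b) - b
    add-sub = solve-∀
    rearrange : ∀ n r → (+ 4 * n * n * n + + 12 * r * n + + 5 * r * r * r + + 4 * r) - (+ 6 * r * r * n + + 4 * n + + 12 * r * r)
                      ≡ + 4 * n * n * n + (+ 12 * r - + 6 * r * r - + 4) * n + (+ 5 * r * r * r - + 12 * r * r + + 4 * r)
    rearrange = solve-∀

open import Data.Nat.Divisibility using (_∣_; divides)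
open import Data.Integer using (+_; _+_; _-_; _*_)
open import Relation.Binary.PropositionalEquality using (_≡_; refl; sym; trans; cong; subst₂)
import Data.Nat as ℕ
open import Data.Nat.Properties using (+-comm; <⇒≤; m≤n⇒∃[o]m+o≡n)
open import Data.Nat.Tactic.RingSolver using (solve-∀)
open import Data.Product using (_,_)
open IntegerForm using (integer-form)

WienerFormula : ℕ → ℕ → Set
WienerFormula n r =
  + 24 * + wiener (lollipop n r)
    ≡ + 4 * + n * + n * + n
      + (+ 12 * + r - + 6 * + r * + r - + 4) * + n
      + (+ 5 * + r * + r * + r - + 12 * + r * + r + + 4 * + r)

-- Write r = 2m with m = p + 1 (r = 0 contradicts 3 ≤ r) and n = i + r; the even-lollipop
-- computation gives the identity over ℕ, which rearranges to the one over ℤ.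
lemma3p12 : (n r : ℕ) → 3 ≤ r → r < n → 2 ∣ r →
    + 24 * + wiener (lollipop n r)
      ≡ + 4 * + n * + n * + n
        + (+ 12 * + r - + 6 * + r * + r - + 4) * + n
        + (+ 5 * + r * + r * + r - + 12 * + r * + r + + 4 * + r)
lemma3p12 n r 3≤r r<n (divides ℕ.zero refl) with () ← 3≤r
lemma3p12 n r 3≤r r<n (divides (ℕ.suc p) r≡[p+1]*2) with m≤n⇒∃[o]m+o≡n (<⇒≤ r<n)
... | i , r+i≡n = subst₂ WienerFormula n≡i+2m r≡2m (integer-form W (i ℕ.+ (m ℕ.+ m)) (m ℕ.+ m) (EvenLollipop.wiener-even p i))
  where
  m W : ℕ
  m = ℕ.suc p
  W = wiener (lollipop (i ℕ.+ (m ℕ.+ m)) (m ℕ.+ m))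
  double : ∀ m → m ℕ.* 2 ≡ m ℕ.+ m
  double = solve-∀
  r≡2m : m ℕ.+ m ≡ r
  r≡2m = sym (trans r≡[p+1]*2 (double m))
  n≡i+2m : i ℕ.+ (m ℕ.+ m) ≡ n
  n≡i+2m = trans (+-comm i (m ℕ.+ m)) (trans (cong (ℕ._+ i) r≡2m) r+i≡n)
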